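{- Let $k,m$ be positive integers, $n=k+m$, let $Q=\{x_1,\dots,x_n\}$ be the complete bipartite poset of type $(k,m)$, $A=\{x_{k+1},\dots,x_n\}$, $M=\mathbf{I}(Q,A)$ with unit group $G$. Let $L$ satisfy $[k]\subseteq L\subseteq[n]$ and put $a=|L|$. If $a>k$, then the $\mathcal{H}$-class of $\mathbf{1}_L$ in $M$ is isomorphic (as a group) to the unit group $\mathbf{G}(Q(a),A(a))$ of the antichain monoid $\mathbf{I}(Q(a),A(a))$, where $Q(a)=\{x_1,\dots,x_a\}$ is the complete bipartite poset with minimal elements $x_1,\dots,x_k$ and maximal elements $x_{k+1},\dots,x_a$, and $A(a)=\{x_{k+1},\dots,x_a\}$.
   Context: Work over $\mathbb{C}$. The complete bipartite poset of type $(k,m)$ is $Q=\{x_1,\dots,x_n\}$ with $x_i<x_j$ iff $i\le k<j$ and no other strict relations. For a poset $P=\{x_1,\dots,x_N\}$ listed along a linear extension and an antichain $A$, $\mathbf{T}_N(A)$ is the group of invertible diagonal matrices $\mathrm{diag}(t_1,\dots,t_N)$ with $t_i=1$ if $x_i\notin A$, $\mathbf{U}_N(P)$ is the group of upper triangular unipotent matrices $(a_{ij})$ with $a_{ij}=0$ whenever $x_i\not\le x_j$, and $\mathbf{I}(P,A)$ is the Zariski closure of $\mathbf{T}_N(A)\ltimes\mathbf{U}_N(P)$, with unit group $\mathbf{G}(P,A)=\mathbf{T}_N(A)\ltimes\mathbf{U}_N(P)$. Thus $M=\{\begin{bmatrix}\mathbf{1}_k&B\\0&D\end{bmatrix}: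 B\in\mathrm{Mat}_{k,m},\ D\text{ diagonal }m\times m\}$. For $L\subseteq[n]$, $\mathbf{1}_L$ is the diagonal matrix with $j$-th diagonal entry $1$ if $j\in L$ and $0$ otherwise. The $\mathcal{H}$-class of $a$ in $M$ is the set of $b$ with $aM=bM$ and $Ma=Mb$. -}

module Defs where

open import Level using (Level; _⊔_)
open import Data.Nat using (ℕ; zero; suc; _<_; _≥_)
open import Data.Fin using (Fin; toℕ)
import Data.Fin
import Relation.Nullary
open import Data.Fin.Subset using (Subset; _∈_; _∉_)
open import Data.Bool using (Bool; true; false; if_then_else_)
open import Data.Vec using (lookup)
open import Data.Product using (Σ; _×_; ∃; _,_; proj₁)
open import Relation.Nullary using (¬_)
open import Relation.Binary.PropositionalEquality using (_≡_)
open import Algebra.Bundles using (CommutativeRing)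

-- A field: a commutative ring with 1 ≉ 0 in which every nonzero element
-- has a multiplicative inverse.  (Plays the role of ℂ.)
record Field (c ℓ : Level) : Set (Level.suc (c ⊔ ℓ)) where
  field
    commRing : CommutativeRing c ℓ
  open CommutativeRing commRing public
  field
    1≉0     : ¬ (1# ≈ 0#)
    inverse : ∀ x → ¬ (x ≈ 0#) → ∃ λ y → x * y ≈ 1#

module Matrices {c ℓ : Level} (K : Field c ℓ) where
  open Field K

  Mat : ℕ → Set c
  Mat N = Fin N → Fin N → Carrier

  _≈ᴹ_ : ∀ {N} → Mat N → Mat N → Set ℓ
  A ≈ᴹ B = ∀ i j → A i j ≈ B i j

  sumᶠ : ∀ N → (Fin N → Carrier) → Carrier
  sumᶠ zero    f = 0#
  sumᶠ (suc N) f = f Fin.zero + sumᶠ N (λ l → f (Fin.suc l))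

  _·_ : ∀ {N} → Mat N → Mat N → Mat N
  (A · B) i j = sumᶠ _ (λ l → A i l * B l j)

  δ : ∀ {N} → Fin N → Fin N → Carrier
  δ i j with i Data.Fin.≟ j
  ... | Relation.Nullary.yes _ = 1#
  ... | Relation.Nullary.no  _ = 0#

  𝟏 : ∀ {N} → Subset N → Mat N
  𝟏 L i j with i Data.Fin.≟ j
  ... | Relation.Nullary.no  _ = 0#
  ... | Relation.Nullary.yes _ = if lookup L i then 1# else 0#

  -- Membership in I(Q,A) for the complete bipartite poset Q of type (k, N - k)
  -- with A = {x_{k+1},…,x_N}: matrices [[1_k, B],[0, D]] with B arbitrary,
  -- D diagonal (indices 0..k-1 in Fin N correspond to x_1,…,x_k).
  InI : (k N : ℕ) → Mat N → Set ℓ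
  InI k N X = ∀ i j →
      (toℕ i < k → toℕ j < k → X i j ≈ δ i j)
    × (toℕ i ≥ k → toℕ j < k → X i j ≈ 0#)
    × (toℕ i ≥ k → toℕ j ≥ k → ¬ (i ≡ j) → X i j ≈ 0#)

  -- Membership in the unit group G(Q,A) = T_N(A) ⋉ U_N(Q):
  -- elements of I(Q,A) whose diagonal entries in D are invertible.
  InG : (k N : ℕ) → Mat N → Set (c ⊔ ℓ)
  InG k N X = InI k N X × (∀ i → toℕ i ≥ k → ∃ λ y → X i i * y ≈ 1#)

  -- equality of right ideals  X M = Y M  inside M = I(Q,A) (as sets)
  _ᴿ≡_within_ : ∀ {N} → Mat N → Mat N → (Mat N → Set ℓ) → Set (c ⊔ ℓ)
  X ᴿ≡ Y within InM =
      (∀ Z → InM Z → Σ _ λ W → InM W × ((X · Z) ≈ᴹ (Y · W)))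
    × (∀ W → InM W → Σ _ λ Z → InM Z × ((Y · W) ≈ᴹ (X · Z)))

  -- equality of left ideals  M X = M Y  inside M (as sets)
  _ᴸ≡_within_ : ∀ {N} → Mat N → Mat N → (Mat N → Set ℓ) → Set (c ⊔ ℓ)
  X ᴸ≡ Y within InM =
      (∀ Z → InM Z → Σ _ λ W → InM W × ((Z · X) ≈ᴹ (W · Y)))
    × (∀ W → InM W → Σ _ λ Z → InM Z × ((W · Y) ≈ᴹ (Z · X)))

  InH : (k N : ℕ) → Mat N → Mat N → Set (c ⊔ ℓ)
  InH k N E X = InI k N X × (E ᴿ≡ X within InI k N) × (E ᴸ≡ X within InI k N)

  record HIsoG (k N a : ℕ) (E : Mat N) : Set (c ⊔ ℓ) where
    field
      closed : ∀ X Y → InH k N E X → InH k N E Y → InH k N E (X · Y)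
      φ      : Σ (Mat N) (InH k N E) → Σ (Mat a) (InG k a)
      φ-cong : ∀ x y → proj₁ x ≈ᴹ proj₁ y → proj₁ (φ x) ≈ᴹ proj₁ (φ y)
      φ-inj  : ∀ x y → proj₁ (φ x) ≈ᴹ proj₁ (φ y) → proj₁ x ≈ᴹ proj₁ y
      φ-surj : ∀ (y : Σ (Mat a) (InG k a)) → Σ (Σ (Mat N) (InH k N E)) λ x → proj₁ (φ x) ≈ᴹ proj₁ y
      φ-hom  : ∀ X Y (hX : InH k N E X) (hY : InH k N E Y) →
                 proj₁ (φ (X · Y , closed X Y hX hY))
                   ≈ᴹ (proj₁ (φ (X , hX)) · proj₁ (φ (Y , hY)))

-- The 𝓗-class of the idempotent 𝟏_L is the unit group of the corner monoid 𝟏_L M 𝟏_L: the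
-- matrices [[1_k, B], [0, D]] of M vanishing on the columns (hence the rows) outside L whose
-- diagonal entries on L ∖ [k] are invertible.  As [k] ⊆ L, restricting to L × L lands in
-- G(Q(a), A(a)) and extension by zero inverts it; both maps are multiplicative since every
-- matrix involved vanishes off L × L.  A unit Y = [[1, B], [0, D]] of G has the inverse
-- [[1, −BD⁻¹], [0, D⁻¹]], and its extension by zero is the inverse in the corner that places
-- the matrix in the 𝓗-class.

module Submission where

open import Level using (_⊔_)
open import Data.Nat as ℕ using (ℕ; _<_; _≥_; _≤_; z≤n; s≤s; _<?_)
open import Data.Nat.Properties using (m≤n⇒m≤1+n; ≮⇒≥; <⇒≱; ≤-trans; ≤-<-trans)
open import Data.Fin using (Fin; zero; suc; toℕ; _≟_; punchIn; punchOut)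
open import Data.Fin.Properties using (punchInᵢ≢i; punchIn-injective; punchIn-punchOut)
open import Data.Fin.Subset using (Subset; _∈_; ∣_∣)
open import Data.Bool using (true; false)
open import Data.Bool.Properties using (not-¬)
open import Data.Vec using ([]; _∷_; lookup)
open import Data.Vec.Properties using ([]=⇒lookup)
open import Data.Maybe using (Maybe; just; nothing)
import Data.Maybe
open import Data.Maybe.Properties using (just-injective)
open import Data.Product using (Σ; _×_; ∃; _,_; proj₁; proj₂)
open import Data.Sum using (_⊎_; inj₁; inj₂; [_,_])
open import Data.Empty using (⊥-elim)
open import Function using (_∘_)
open import Relation.Nullary using (yes; no)
import Relation.Binary.PropositionalEquality as ≡
open ≡ using (_≡_; _≢_)
open import Relation.Binary.Bundles using (Setoid)
import Relation.Binary.Reasoning.Setoid as SetoidReasoning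
open import Defs

embed : ∀ {N} (L : Subset N) → Fin ∣ L ∣ → Fin N
embed (true  ∷ L) zero    = zero
embed (true  ∷ L) (suc i) = suc (embed L i)
embed (false ∷ L) i       = suc (embed L i)

position : ∀ {N} (L : Subset N) → Fin N → Maybe (Fin ∣ L ∣)
position (true  ∷ L) zero    = just zero
position (true  ∷ L) (suc j) = Data.Maybe.map suc (position L j)
position (false ∷ L) zero    = nothing
position (false ∷ L) (suc j) = position L j

position-embed : ∀ {N} (L : Subset N) i → position L (embed L i) ≡ just i
position-embed (true  ∷ L) zero    = ≡.refl
position-embed (true  ∷ L) (suc i) = ≡.cong (Data.Maybe.map suc) (position-embed L i)
position-embed (false ∷ L) i       = position-embed L i

position-just : ∀ {N} (L : Subset N) j {i} → position L j ≡ just i → embed L i ≡ j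
position-just (true  ∷ L) zero    ≡.refl = ≡.refl
position-just (true  ∷ L) (suc j) eq with position L j in eq′
position-just (true  ∷ L) (suc j) ≡.refl | just i = ≡.cong suc (position-just L j eq′)
position-just (false ∷ L) (suc j) eq = ≡.cong suc (position-just L j eq)

position-nothing : ∀ {N} (L : Subset N) j → position L j ≡ nothing → lookup L j ≡ false
position-nothing (true  ∷ L) (suc j) eq with position L j in eq′
position-nothing (true  ∷ L) (suc j) eq | nothing = position-nothing L j eq′
position-nothing (false ∷ L) zero    eq = ≡.refl
position-nothing (false ∷ L) (suc j) eq = position-nothing L j eq

position-∉ : ∀ {N} (L : Subset N) j → lookup L j ≡ false → position L j ≡ nothing
position-∉ (true  ∷ L) (suc j) j∉L = ≡.cong (Data.Maybe.map suc) (position-∉ L j j∉L)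
position-∉ (false ∷ L) zero    j∉L = ≡.refl
position-∉ (false ∷ L) (suc j) j∉L = position-∉ L j j∉L

embed-∈ : ∀ {N} (L : Subset N) i → lookup L (embed L i) ≡ true
embed-∈ (true  ∷ L) zero    = ≡.refl
embed-∈ (true  ∷ L) (suc i) = embed-∈ L i
embed-∈ (false ∷ L) i       = embed-∈ L i

embed-injective : ∀ {N} (L : Subset N) {i j} → embed L i ≡ embed L j → i ≡ j
embed-injective L {i} {j} eq =
  just-injective (≡.trans (≡.sym (position-embed L i))
                          (≡.trans (≡.cong (position L) eq) (position-embed L j)))

embed-or-∉ : ∀ {N} (L : Subset N) j → (∃ λ j′ → embed L j′ ≡ j) ⊎ lookup L j ≡ false
embed-or-∉ L j with position L j in eq
... | just j′ = inj₁ (j′ , position-just L j eq)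
... | nothing = inj₂ (position-nothing L j eq)

toℕ-embed-≥ : ∀ {N} (L : Subset N) i → toℕ i ≤ toℕ (embed L i)
toℕ-embed-≥ (true  ∷ L) zero    = z≤n
toℕ-embed-≥ (true  ∷ L) (suc i) = s≤s (toℕ-embed-≥ L i)
toℕ-embed-≥ (false ∷ L) i       = m≤n⇒m≤1+n (toℕ-embed-≥ L i)

toℕ-embed-prefix : ∀ {N} (L : Subset N) k → (∀ j → toℕ j < k → lookup L j ≡ true) →
                   ∀ i → toℕ i < k → toℕ (embed L i) ≡ toℕ i
toℕ-embed-prefix (true  ∷ L) (ℕ.suc k) prefix zero    _         = ≡.refl
toℕ-embed-prefix (true  ∷ L) (ℕ.suc k) prefix (suc i) (s≤s i<k) =
  ≡.cong ℕ.suc (toℕ-embed-prefix L k (λ j j<k → prefix (suc j) (s≤s j<k)) i i<k)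
toℕ-embed-prefix (false ∷ L) (ℕ.suc k) prefix i _ with prefix zero (s≤s z≤n)
... | ()

diagonal-cases : ∀ {p N} (P : Fin N → Fin N → Set p) →
                 (∀ i → P i i) → (∀ {i j} → i ≢ j → P i j) → ∀ i j → P i j
diagonal-cases P diag off i j with i ≟ j
... | yes ≡.refl = diag i
... | no  i≢j    = off i≢j

module _ {c ℓ} (K : Field c ℓ) where
  open Field K hiding (zero)
  open Matrices K
  open import Algebra.Properties.Semiring.Sum semiring
    using (sum; sum-cong-≋; sum-replicate-zero; sum-remove; ∑-comm; *-distribˡ-sum; *-distribʳ-sum)
  open import Algebra.Properties.Ring ring using (-‿distribˡ-*; -‿distribʳ-*; -0#≈0#)
  open import Algebra.Properties.CommutativeSemigroup *-commutativeSemigroup using (interchange)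
  open SetoidReasoning setoid

  sumᶠ≡sum : ∀ N (f : Fin N → Carrier) → sumᶠ N f ≡ sum f
  sumᶠ≡sum ℕ.zero    f = ≡.refl
  sumᶠ≡sum (ℕ.suc N) f = ≡.cong (f zero +_) (sumᶠ≡sum N (f ∘ suc))

  sum-zero : ∀ {N} (f : Fin N → Carrier) → (∀ l → f l ≈ 0#) → sum f ≈ 0#
  sum-zero {N} f f≈0 = trans (sum-cong-≋ f≈0) (sum-replicate-zero N)

  sum-single : ∀ {N} {f : Fin N → Carrier} p → (∀ l → l ≢ p → f l ≈ 0#) → sum f ≈ f p
  sum-single {ℕ.suc N} {f} p vanish = begin
    sum f                       ≈⟨ sum-remove f ⟩
    f p + sum (f ∘ punchIn p)   ≈⟨ +-congˡ (sum-zero (f ∘ punchIn p) (λ l → vanish _ (punchInᵢ≢i p l))) ⟩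
    f p + 0#                    ≈⟨ +-identityʳ _ ⟩
    f p                         ∎

  sum-pair : ∀ {N} {f : Fin N → Carrier} p q → p ≢ q → (∀ l → l ≢ p → l ≢ q → f l ≈ 0#) →
             sum f ≈ f p + f q
  sum-pair {ℕ.suc N} {f} p q p≢q vanish = begin
    sum f                                  ≈⟨ sum-remove f ⟩
    f p + sum (f ∘ punchIn p)              ≈⟨ +-congˡ (sum-single q′ vanish′) ⟩
    f p + f (punchIn p q′)                 ≡⟨ ≡.cong (λ l → f p + f l) (punchIn-punchOut p≢q) ⟩
    f p + f q                              ∎
    where
    q′ : Fin N
    q′ = punchOut p≢q
    vanish′ : ∀ l → l ≢ q′ → f (punchIn p l) ≈ 0#
    vanish′ l l≢q′ = vanish _ (punchInᵢ≢i p l)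
      (λ eq → l≢q′ (punchIn-injective p l q′ (≡.trans eq (≡.sym (punchIn-punchOut p≢q)))))

  sum-embed : ∀ {N} (L : Subset N) (f : Fin N → Carrier) → (∀ l → lookup L l ≡ false → f l ≈ 0#) →
              sum f ≈ sum (f ∘ embed L)
  sum-embed []          f vanish = refl
  sum-embed (true  ∷ L) f vanish = +-congˡ (sum-embed L (f ∘ suc) (vanish ∘ suc))
  sum-embed (false ∷ L) f vanish = begin
    f zero + sum (f ∘ suc)         ≈⟨ +-cong (vanish zero ≡.refl) (sum-embed L (f ∘ suc) (vanish ∘ suc)) ⟩
    0# + sum (f ∘ suc ∘ embed L)   ≈⟨ +-identityˡ _ ⟩
    sum (f ∘ suc ∘ embed L)        ∎

  Matˢ : ℕ → Setoid c ℓ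
  Matˢ N = record
    { Carrier       = Mat N
    ; _≈_           = _≈ᴹ_
    ; isEquivalence = record
      { refl  = λ i j → refl
      ; sym   = λ A≈B i j → sym (A≈B i j)
      ; trans = λ A≈B B≈C i j → trans (A≈B i j) (B≈C i j)
      }
    }

  module ≈ᴹ {N} = Setoid (Matˢ N)

  ·-sum : ∀ {N} (A B : Mat N) i j → (A · B) i j ≡ sum (λ l → A i l * B l j)
  ·-sum {N} A B i j = sumᶠ≡sum N _

  ·-single : ∀ {N} (A B : Mat N) i j p → (∀ l → l ≢ p → A i l * B l j ≈ 0#) →
             (A · B) i j ≈ A i p * B p j
  ·-single A B i j p vanish = trans (reflexive (·-sum A B i j)) (sum-single p vanish)

  ·-pair : ∀ {N} (A B : Mat N) i j p q → p ≢ q → (∀ l → l ≢ p → l ≢ q → A i l * B l j ≈ 0#) →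
           (A · B) i j ≈ A i p * B p j + A i q * B q j
  ·-pair A B i j p q p≢q vanish =
    trans (reflexive (·-sum A B i j)) (sum-pair p q p≢q vanish)

  ·-cong : ∀ {N} {A A′ B B′ : Mat N} → A ≈ᴹ A′ → B ≈ᴹ B′ → (A · B) ≈ᴹ (A′ · B′)
  ·-cong {N} A≈A′ B≈B′ i j = sumᶠ-cong N (λ l → *-cong (A≈A′ i l) (B≈B′ l j))
    where
    sumᶠ-cong : ∀ N {f g : Fin N → Carrier} → (∀ l → f l ≈ g l) → sumᶠ N f ≈ sumᶠ N g
    sumᶠ-cong ℕ.zero    f≈g = refl
    sumᶠ-cong (ℕ.suc N) f≈g = +-cong (f≈g zero) (sumᶠ-cong N (f≈g ∘ suc))

  ·-assoc : ∀ {N} (A B C : Mat N) → ((A · B) · C) ≈ᴹ (A · (B · C))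
  ·-assoc A B C i j = begin
    ((A · B) · C) i j                                 ≡⟨ ·-sum (A · B) C i j ⟩
    sum (λ l → (A · B) i l * C l j)                   ≈⟨ sum-cong-≋ (λ l → *-congʳ (reflexive (·-sum A B i l))) ⟩
    sum (λ l → sum (λ m → A i m * B m l) * C l j)     ≈⟨ sum-cong-≋ (λ l → *-distribʳ-sum (C l j) (λ m → A i m * B m l)) ⟩
    sum (λ l → sum (λ m → A i m * B m l * C l j))     ≈⟨ ∑-comm (λ l m → A i m * B m l * C l j) ⟩
    sum (λ m → sum (λ l → A i m * B m l * C l j))     ≈⟨ sum-cong-≋ (λ m → sum-cong-≋ (λ l → *-assoc (A i m) (B m l) (C l j))) ⟩
    sum (λ m → sum (λ l → A i m * (B m l * C l j)))   ≈⟨ sum-cong-≋ (λ m → *-distribˡ-sum (A i m) (λ l → B m l * C l j)) ⟨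
    sum (λ m → A i m * sum (λ l → B m l * C l j))     ≈⟨ sum-cong-≋ (λ m → *-congˡ (reflexive (·-sum B C m j))) ⟨
    sum (λ m → A i m * (B · C) m j)                   ≡⟨ ·-sum A (B · C) i j ⟨
    (A · (B · C)) i j                                 ∎

  δ-diag : ∀ {N} (i : Fin N) → δ i i ≈ 1#
  δ-diag i with i ≟ i
  ... | yes _  = refl
  ... | no i≢i = ⊥-elim (i≢i ≡.refl)

  δ-off : ∀ {N} {i j : Fin N} → i ≢ j → δ i j ≈ 0#
  δ-off {i = i} {j} i≢j with i ≟ j
  ... | yes i≡j = ⊥-elim (i≢j i≡j)
  ... | no _    = refl

  ·-identityˡ : ∀ {N} (A : Mat N) → (δ · A) ≈ᴹ A
  ·-identityˡ A i j = begin
    (δ · A) i j   ≈⟨ ·-single δ A i j i (λ l l≢i → trans (*-congʳ (δ-off (l≢i ∘ ≡.sym))) (zeroˡ _)) ⟩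
    δ i i * A i j ≈⟨ *-congʳ (δ-diag i) ⟩
    1# * A i j    ≈⟨ *-identityˡ _ ⟩
    A i j         ∎

  ·-identityʳ : ∀ {N} (A : Mat N) → (A · δ) ≈ᴹ A
  ·-identityʳ A i j = begin
    (A · δ) i j   ≈⟨ ·-single A δ i j j (λ l l≢j → trans (*-congˡ (δ-off l≢j)) (zeroʳ _)) ⟩
    A i j * δ j j ≈⟨ *-congˡ (δ-diag j) ⟩
    A i j * 1#    ≈⟨ *-identityʳ _ ⟩
    A i j         ∎

  𝟏-off : ∀ {N} (L : Subset N) {i j} → i ≢ j → 𝟏 L i j ≈ 0#
  𝟏-off L {i} {j} i≢j with i ≟ j
  ... | yes i≡j = ⊥-elim (i≢j i≡j)
  ... | no _    = refl

  𝟏-∈ : ∀ {N} (L : Subset N) i → lookup L i ≡ true → 𝟏 L i i ≈ 1#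
  𝟏-∈ L i i∈L with i ≟ i
  ... | no i≢i = ⊥-elim (i≢i ≡.refl)
  ... | yes _ rewrite i∈L = refl

  𝟏-∉ : ∀ {N} (L : Subset N) i → lookup L i ≡ false → 𝟏 L i i ≈ 0#
  𝟏-∉ L i i∉L with i ≟ i
  ... | no i≢i = ⊥-elim (i≢i ≡.refl)
  ... | yes _ rewrite i∉L = refl

  module Restriction {N} (L : Subset N) where

    Supported : Mat N → Set ℓ
    Supported X = ∀ i j → lookup L i ≡ false ⊎ lookup L j ≡ false → X i j ≈ 0#

    sub : Mat N → Mat ∣ L ∣
    sub X i j = X (embed L i) (embed L j)

    lift : Mat ∣ L ∣ → Maybe (Fin ∣ L ∣) → Maybe (Fin ∣ L ∣) → Carrier
    lift Y (just i) (just j) = Y i j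
    lift Y (just i) nothing  = 0#
    lift Y nothing  _        = 0#

    ext : Mat ∣ L ∣ → Mat N
    ext Y i j = lift Y (position L i) (position L j)

    sub-ext : ∀ Y → sub (ext Y) ≈ᴹ Y
    sub-ext Y i j = reflexive (≡.cong₂ (lift Y) (position-embed L i) (position-embed L j))

    ext-cong : ∀ {Y Y′} → Y ≈ᴹ Y′ → ext Y ≈ᴹ ext Y′
    ext-cong {Y} {Y′} Y≈Y′ i j = lift-cong (position L i) (position L j)
      where
      lift-cong : ∀ p q → lift Y p q ≈ lift Y′ p q
      lift-cong (just i) (just j) = Y≈Y′ i j
      lift-cong (just i) nothing  = refl
      lift-cong nothing  _        = refl

    ext-supported : ∀ Y → Supported (ext Y)
    ext-supported Y i j (inj₁ i∉L) rewrite position-∉ L i i∉L = refl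
    ext-supported Y i j (inj₂ j∉L) rewrite position-∉ L j j∉L = lift-nothingʳ (position L i)
      where
      lift-nothingʳ : ∀ p → lift Y p nothing ≈ 0#
      lift-nothingʳ (just _) = refl
      lift-nothingʳ nothing  = refl

    ext-sub : ∀ {X} → Supported X → X ≈ᴹ ext (sub X)
    ext-sub {X} supp i j with embed-or-∉ L i | embed-or-∉ L j
    ... | inj₁ (i′ , ≡.refl) | inj₁ (j′ , ≡.refl) = sym (sub-ext (sub X) i′ j′)
    ... | inj₂ i∉L | _        = trans (supp i j (inj₁ i∉L)) (sym (ext-supported (sub X) i j (inj₁ i∉L)))
    ... | inj₁ _   | inj₂ j∉L = trans (supp i j (inj₂ j∉L)) (sym (ext-supported (sub X) i j (inj₂ j∉L)))

    sub-· : ∀ {X} → Supported X → ∀ Y → sub (X · Y) ≈ᴹ (sub X · sub Y)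
    sub-· {X} supp Y i j = begin
      sub (X · Y) i j                                      ≡⟨ ·-sum X Y _ _ ⟩
      sum (λ l → X (embed L i) l * Y l (embed L j))        ≈⟨ sum-embed L _ (λ l l∉L →
                                                                trans (*-congʳ (supp _ l (inj₂ l∉L))) (zeroˡ _)) ⟩
      sum (λ l → sub X i l * sub Y l j)                    ≡⟨ ·-sum (sub X) (sub Y) i j ⟨
      (sub X · sub Y) i j                                  ∎

    ext-· : ∀ Y Z → (ext Y · ext Z) ≈ᴹ ext (Y · Z)
    ext-· Y Z i j = begin
      (ext Y · ext Z) i j                                  ≡⟨ ·-sum (ext Y) (ext Z) i j ⟩
      sum (λ l → ext Y i l * ext Z l j)                    ≈⟨ sum-embed L _ (λ l l∉L →
                                                                trans (*-congˡ (ext-supported Z l j (inj₁ l∉L))) (zeroʳ _)) ⟩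
      sum (λ l → ext Y i (embed L l) * ext Z (embed L l) j)
                                                           ≈⟨ sum-cong-≋ (λ l → reflexive (≡.cong₂ _*_
                                                                (≡.cong (lift Y (position L i)) (position-embed L l))
                                                                (≡.cong (λ p → lift Z p (position L j)) (position-embed L l)))) ⟩
      sum (λ l → lift Y (position L i) (just l) * lift Z (just l) (position L j))
                                                           ≈⟨ lift-· (position L i) (position L j) ⟩
      lift (Y · Z) (position L i) (position L j)           ∎
      where
      lift-· : ∀ p q → sum (λ l → lift Y p (just l) * lift Z (just l) q) ≈ lift (Y · Z) p q
      lift-· (just i) (just j) = reflexive (≡.sym (·-sum Y Z i j))
      lift-· (just i) nothing  = sum-zero _ (λ l → zeroʳ (Y i l))
      lift-· nothing  q        = sum-zero _ (λ l → zeroˡ (lift Z (just l) q))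

    ·-via-ext : ∀ {A B C P Q R} → P ≈ᴹ ext A → Q ≈ᴹ ext B → (A · B) ≈ᴹ C → ext C ≈ᴹ R → (P · Q) ≈ᴹ R
    ·-via-ext {A} {B} P≈A Q≈B AB≈C C≈R =
      ≈ᴹ.trans (·-cong P≈A Q≈B) (≈ᴹ.trans (ext-· A B) (≈ᴹ.trans (ext-cong AB≈C) C≈R))

    δ-embed : ∀ i j → δ (embed L i) (embed L j) ≈ δ i j
    δ-embed = diagonal-cases (λ i j → δ (embed L i) (embed L j) ≈ δ i j)
      (λ i → trans (δ-diag (embed L i)) (sym (δ-diag i)))
      (λ i≢j → trans (δ-off (i≢j ∘ embed-injective L)) (sym (δ-off i≢j)))

    𝟏-supported : Supported (𝟏 L)
    𝟏-supported = diagonal-cases (λ i j → lookup L i ≡ false ⊎ lookup L j ≡ false → 𝟏 L i j ≈ 0#)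
      (λ i → [ 𝟏-∉ L i , 𝟏-∉ L i ])
      (λ i≢j _ → 𝟏-off L i≢j)

    sub-𝟏 : sub (𝟏 L) ≈ᴹ δ
    sub-𝟏 = diagonal-cases (λ i j → 𝟏 L (embed L i) (embed L j) ≈ δ i j)
      (λ i → trans (𝟏-∈ L (embed L i) (embed-∈ L i)) (sym (δ-diag i)))
      (λ i≢j → trans (𝟏-off L (i≢j ∘ embed-injective L)) (sym (δ-off i≢j)))

    ext-δ : ext δ ≈ᴹ 𝟏 L
    ext-δ = ≈ᴹ.trans (ext-cong (≈ᴹ.sym sub-𝟏)) (≈ᴹ.sym (ext-sub 𝟏-supported))

  module Bipartite (k : ℕ) where

    ≥-<-≢ : ∀ {n} {i j : Fin n} → toℕ i ≥ k → toℕ j < k → i ≢ j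
    ≥-<-≢ i≥k j<k ≡.refl = <⇒≱ j<k i≥k

    left-column : ∀ {n} {X : Mat n} → InI k n X → ∀ i {j} → toℕ j < k → X i j ≈ δ i j
    left-column hX i {j} j<k with toℕ i <? k
    ... | yes i<k = proj₁ (hX i j) i<k j<k
    ... | no  i≮k = trans (proj₁ (proj₂ (hX i j)) (≮⇒≥ i≮k) j<k) (sym (δ-off (≥-<-≢ (≮⇒≥ i≮k) j<k)))

    lower-row-off : ∀ {n} {X : Mat n} → InI k n X → ∀ {i j} → toℕ i ≥ k → i ≢ j → X i j ≈ 0#
    lower-row-off hX {i} {j} i≥k i≢j with toℕ j <? k
    ... | yes j<k = proj₁ (proj₂ (hX i j)) i≥k j<k
    ... | no  j≮k = proj₂ (proj₂ (hX i j)) i≥k (≮⇒≥ j≮k) i≢j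

    -- The poset has no chains of length two: i < l < j never happens.
    chain-vanishes : ∀ {n} {X : Mat n} → InI k n X → ∀ {i l j} → l ≢ i → l ≢ j →
                     X i l ≈ 0# ⊎ X l j ≈ 0#
    chain-vanishes hX {i} {l} l≢i l≢j with toℕ l <? k
    ... | yes l<k = inj₁ (trans (left-column hX i l<k) (δ-off (l≢i ∘ ≡.sym)))
    ... | no  l≮k = inj₂ (lower-row-off hX (≮⇒≥ l≮k) l≢j)

    diagonal-absorbˡ : ∀ {n} {X : Mat n} → InI k n X → ∀ {i j} → i ≢ j → X i i * X i j ≈ X i j
    diagonal-absorbˡ {X = X} hX {i} {j} i≢j with toℕ i <? k
    ... | yes i<k = trans (*-congʳ (trans (left-column hX i i<k) (δ-diag i))) (*-identityˡ _)
    ... | no  i≮k = trans (*-congˡ Xij≈0) (trans (zeroʳ _) (sym Xij≈0))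
      where
      Xij≈0 : X i j ≈ 0#
      Xij≈0 = lower-row-off hX (≮⇒≥ i≮k) i≢j

    ·-left-column : ∀ {n} (X : Mat n) {Y} → InI k n Y → ∀ i {j} → toℕ j < k → (X · Y) i j ≈ X i j
    ·-left-column X {Y} hY i {j} j<k = begin
      (X · Y) i j   ≈⟨ ·-single X Y i j j (λ l l≢j → trans (*-congˡ (trans (left-column hY l j<k) (δ-off l≢j))) (zeroʳ _)) ⟩
      X i j * Y j j ≈⟨ *-congˡ (trans (left-column hY j j<k) (δ-diag j)) ⟩
      X i j * 1#    ≈⟨ *-identityʳ _ ⟩
      X i j         ∎

    ·-lower-row : ∀ {n} {X : Mat n} → InI k n X → ∀ Y {i} j → toℕ i ≥ k → (X · Y) i j ≈ X i i * Y i j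
    ·-lower-row {X = X} hX Y {i} j i≥k =
      ·-single X Y i j i (λ l l≢i → trans (*-congʳ (lower-row-off hX i≥k (l≢i ∘ ≡.sym))) (zeroˡ _))

    InI-· : ∀ {n} {X Y : Mat n} → InI k n X → InI k n Y → InI k n (X · Y)
    InI-· {X = X} {Y} hX hY i j =
        (λ i<k j<k → trans (·-left-column X hY i j<k) (proj₁ (hX i j) i<k j<k))
      , (λ i≥k j<k → trans (·-left-column X hY i j<k) (proj₁ (proj₂ (hX i j)) i≥k j<k))
      , (λ i≥k j≥k i≢j → trans (·-lower-row hX Y j i≥k)
                                (trans (*-congˡ (proj₂ (proj₂ (hY i j)) i≥k j≥k i≢j)) (zeroʳ _)))

    δ-InI : ∀ {n} → InI k n δ
    δ-InI i j = (λ _ _ → refl) , (λ i≥k j<k → δ-off (≥-<-≢ i≥k j<k)) , (λ _ _ → δ-off)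

    module Inverse {n} {Y : Mat n} (gY : InG k n Y) where
      private
        hY : InI k n Y
        hY = proj₁ gY

      -- In the upper block Y j j ≈ 1#, so 1# inverts it there.
      d⁻¹ : Fin n → Carrier
      d⁻¹ j with toℕ j <? k
      ... | yes _   = 1#
      ... | no  j≮k = proj₁ (proj₂ gY j (≮⇒≥ j≮k))

      d⁻¹-upper : ∀ {j} → toℕ j < k → d⁻¹ j ≈ 1#
      d⁻¹-upper {j} j<k with toℕ j <? k
      ... | yes _   = refl
      ... | no  j≮k = ⊥-elim (j≮k j<k)

      diag-inverseʳ : ∀ j → Y j j * d⁻¹ j ≈ 1#
      diag-inverseʳ j with toℕ j <? k
      ... | yes j<k = trans (*-identityʳ _) (trans (left-column hY j j<k) (δ-diag j))
      ... | no  j≮k = proj₂ (proj₂ gY j (≮⇒≥ j≮k))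

      d⁻¹-absorbˡ : ∀ {i j} → i ≢ j → d⁻¹ i * Y i j ≈ Y i j
      d⁻¹-absorbˡ {i} {j} i≢j with toℕ i <? k
      ... | yes _   = *-identityˡ _
      ... | no  i≮k = trans (*-congˡ Yij≈0) (trans (zeroʳ _) (sym Yij≈0))
        where
        Yij≈0 : Y i j ≈ 0#
        Yij≈0 = lower-row-off hY (≮⇒≥ i≮k) i≢j

      -- [[1, −BD⁻¹], [0, D⁻¹]] entrywise; uniform in the blocks since Y vanishes off B and the diagonal.
      Y⁻¹ : Mat n
      Y⁻¹ i j with i ≟ j
      ... | yes _ = d⁻¹ j
      ... | no  _ = - (Y i j * d⁻¹ j)

      Y⁻¹-diag : ∀ j → Y⁻¹ j j ≈ d⁻¹ j
      Y⁻¹-diag j with j ≟ j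
      ... | yes _  = refl
      ... | no j≢j = ⊥-elim (j≢j ≡.refl)

      Y⁻¹-off : ∀ {i j} → i ≢ j → Y⁻¹ i j ≈ - (Y i j * d⁻¹ j)
      Y⁻¹-off {i} {j} i≢j with i ≟ j
      ... | yes i≡j = ⊥-elim (i≢j i≡j)
      ... | no _    = refl

      Y⁻¹-vanish : ∀ {i j} → i ≢ j → Y i j ≈ 0# → Y⁻¹ i j ≈ 0#
      Y⁻¹-vanish i≢j Yij≈0 =
        trans (Y⁻¹-off i≢j) (trans (-‿cong (trans (*-congʳ Yij≈0) (zeroˡ _))) -0#≈0#)

      Y⁻¹-left-column : ∀ i {j} → toℕ j < k → Y⁻¹ i j ≈ δ i j
      Y⁻¹-left-column i {j} = diagonal-cases (λ i j → toℕ j < k → Y⁻¹ i j ≈ δ i j)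
        (λ j j<k → trans (Y⁻¹-diag j) (trans (d⁻¹-upper j<k) (sym (δ-diag j))))
        (λ {i} i≢j j<k → trans (Y⁻¹-vanish i≢j (trans (left-column hY i j<k) (δ-off i≢j))) (sym (δ-off i≢j)))
        i j

      Y⁻¹-InI : InI k n Y⁻¹
      Y⁻¹-InI i j =
          (λ _ j<k → Y⁻¹-left-column i j<k)
        , (λ i≥k j<k → trans (Y⁻¹-left-column i j<k) (δ-off (≥-<-≢ i≥k j<k)))
        , (λ i≥k _ i≢j → Y⁻¹-vanish i≢j (lower-row-off hY i≥k i≢j))

      Y·Y⁻¹-term : ∀ {i l j} → l ≢ i → l ≢ j → Y i l * Y⁻¹ l j ≈ 0#
      Y·Y⁻¹-term l≢i l≢j with chain-vanishes hY l≢i l≢j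
      ... | inj₁ Yil≈0 = trans (*-congʳ Yil≈0) (zeroˡ _)
      ... | inj₂ Ylj≈0 = trans (*-congˡ (Y⁻¹-vanish l≢j Ylj≈0)) (zeroʳ _)

      Y⁻¹·Y-term : ∀ {i l j} → l ≢ i → l ≢ j → Y⁻¹ i l * Y l j ≈ 0#
      Y⁻¹·Y-term l≢i l≢j with chain-vanishes hY l≢i l≢j
      ... | inj₁ Yil≈0 = trans (*-congʳ (Y⁻¹-vanish (l≢i ∘ ≡.sym) Yil≈0)) (zeroˡ _)
      ... | inj₂ Ylj≈0 = trans (*-congˡ Ylj≈0) (zeroʳ _)

      ·-inverseʳ : (Y · Y⁻¹) ≈ᴹ δ
      ·-inverseʳ = diagonal-cases (λ i j → (Y · Y⁻¹) i j ≈ δ i j) diag off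
        where
        diag : ∀ i → (Y · Y⁻¹) i i ≈ δ i i
        diag i = begin
          (Y · Y⁻¹) i i     ≈⟨ ·-single Y Y⁻¹ i i i (λ l l≢i → Y·Y⁻¹-term l≢i l≢i) ⟩
          Y i i * Y⁻¹ i i   ≈⟨ *-congˡ (Y⁻¹-diag i) ⟩
          Y i i * d⁻¹ i     ≈⟨ diag-inverseʳ i ⟩
          1#                ≈⟨ δ-diag i ⟨
          δ i i             ∎
        off : ∀ {i j} → i ≢ j → (Y · Y⁻¹) i j ≈ δ i j
        off {i} {j} i≢j = begin
          (Y · Y⁻¹) i j                                   ≈⟨ ·-pair Y Y⁻¹ i j i j i≢j (λ l → Y·Y⁻¹-term) ⟩
          Y i i * Y⁻¹ i j + Y i j * Y⁻¹ j j               ≈⟨ +-cong (*-congˡ (Y⁻¹-off i≢j)) (*-congˡ (Y⁻¹-diag j)) ⟩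
          Y i i * - (Y i j * d⁻¹ j) + Y i j * d⁻¹ j       ≈⟨ +-congʳ (-‿distribʳ-* _ _) ⟨
          - (Y i i * (Y i j * d⁻¹ j)) + Y i j * d⁻¹ j     ≈⟨ +-congʳ (-‿cong (trans (sym (*-assoc _ _ _))
                                                                        (*-congʳ (diagonal-absorbˡ hY i≢j)))) ⟩
          - (Y i j * d⁻¹ j) + Y i j * d⁻¹ j               ≈⟨ -‿inverseˡ _ ⟩
          0#                                              ≈⟨ δ-off i≢j ⟨
          δ i j                                           ∎

      ·-inverseˡ : (Y⁻¹ · Y) ≈ᴹ δ
      ·-inverseˡ = diagonal-cases (λ i j → (Y⁻¹ · Y) i j ≈ δ i j) diag off
        where
        diag : ∀ i → (Y⁻¹ · Y) i i ≈ δ i i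
        diag i = begin
          (Y⁻¹ · Y) i i     ≈⟨ ·-single Y⁻¹ Y i i i (λ l l≢i → Y⁻¹·Y-term l≢i l≢i) ⟩
          Y⁻¹ i i * Y i i   ≈⟨ *-congʳ (Y⁻¹-diag i) ⟩
          d⁻¹ i * Y i i     ≈⟨ *-comm _ _ ⟩
          Y i i * d⁻¹ i     ≈⟨ diag-inverseʳ i ⟩
          1#                ≈⟨ δ-diag i ⟨
          δ i i             ∎
        off : ∀ {i j} → i ≢ j → (Y⁻¹ · Y) i j ≈ δ i j
        off {i} {j} i≢j = begin
          (Y⁻¹ · Y) i j                                   ≈⟨ ·-pair Y⁻¹ Y i j i j i≢j (λ l → Y⁻¹·Y-term) ⟩
          Y⁻¹ i i * Y i j + Y⁻¹ i j * Y j j               ≈⟨ +-cong (*-congʳ (Y⁻¹-diag i)) (*-congʳ (Y⁻¹-off i≢j)) ⟩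
          d⁻¹ i * Y i j + - (Y i j * d⁻¹ j) * Y j j       ≈⟨ +-cong (d⁻¹-absorbˡ i≢j) (sym (-‿distribˡ-* _ _)) ⟩
          Y i j + - (Y i j * d⁻¹ j * Y j j)               ≈⟨ +-congˡ (-‿cong (trans (*-assoc _ _ _)
                                                                (trans (*-congˡ (trans (*-comm _ _) (diag-inverseʳ j)))
                                                                       (*-identityʳ _)))) ⟩
          Y i j + - Y i j                                 ≈⟨ -‿inverseʳ _ ⟩
          0#                                              ≈⟨ δ-off i≢j ⟨
          δ i j                                           ∎

    InH-of-inverse : ∀ {N} {E X X′ : Mat N} → InI k N X → InI k N X′ →
                     (X · X′) ≈ᴹ E → (X′ · X) ≈ᴹ E → (E · X) ≈ᴹ X → (X · E) ≈ᴹ X → InH k N E X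
    InH-of-inverse {E = E} {X} {X′} hX hX′ XX′≈E X′X≈E EX≈X XE≈X =
      hX , (E·-⊆-X· , X·-⊆-E·) , (·E-⊆-·X , ·X-⊆-·E)
      where
      E·-⊆-X· : ∀ Z → InI k _ Z → Σ _ λ W → InI k _ W × (E · Z) ≈ᴹ (X · W)
      E·-⊆-X· Z hZ = X′ · Z , InI-· hX′ hZ , ≈ᴹ.trans (·-cong (≈ᴹ.sym XX′≈E) ≈ᴹ.refl) (·-assoc X X′ Z)
      X·-⊆-E· : ∀ W → InI k _ W → Σ _ λ Z → InI k _ Z × (X · W) ≈ᴹ (E · Z)
      X·-⊆-E· W hW = X · W , InI-· hX hW , ≈ᴹ.trans (·-cong (≈ᴹ.sym EX≈X) ≈ᴹ.refl) (·-assoc E X W)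
      ·E-⊆-·X : ∀ Z → InI k _ Z → Σ _ λ W → InI k _ W × (Z · E) ≈ᴹ (W · X)
      ·E-⊆-·X Z hZ = Z · X′ , InI-· hZ hX′ , ≈ᴹ.trans (·-cong ≈ᴹ.refl (≈ᴹ.sym X′X≈E)) (≈ᴹ.sym (·-assoc Z X′ X))
      ·X-⊆-·E : ∀ W → InI k _ W → Σ _ λ Z → InI k _ Z × (W · X) ≈ᴹ (Z · E)
      ·X-⊆-·E W hW = W · X , InI-· hW hX , ≈ᴹ.trans (·-cong ≈ᴹ.refl (≈ᴹ.sym XE≈X)) (≈ᴹ.sym (·-assoc W X E))

    module Corner {N} (L : Subset N) (upper⊆L : ∀ (i : Fin N) → toℕ i < k → lookup L i ≡ true) where
      open Restriction L

      ∉⇒≥ : ∀ {i} → lookup L i ≡ false → toℕ i ≥ k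
      ∉⇒≥ {i} i∉L with toℕ i <? k
      ... | yes i<k = ⊥-elim (not-¬ (upper⊆L i i<k) i∉L)
      ... | no  i≮k = ≮⇒≥ i≮k

      embed-pres-< : ∀ {i} → toℕ i < k → toℕ (embed L i) < k
      embed-pres-< {i} i<k = ≡.subst (_< k) (≡.sym (toℕ-embed-prefix L k upper⊆L i i<k)) i<k

      embed-refl-< : ∀ {i} → toℕ (embed L i) < k → toℕ i < k
      embed-refl-< {i} = ≤-<-trans (toℕ-embed-≥ L i)

      embed-pres-≥ : ∀ {i} → toℕ i ≥ k → toℕ (embed L i) ≥ k
      embed-pres-≥ {i} i≥k = ≤-trans i≥k (toℕ-embed-≥ L i)

      embed-refl-≥ : ∀ {i} → toℕ (embed L i) ≥ k → toℕ i ≥ k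
      embed-refl-≥ {i} ιi≥k with toℕ i <? k
      ... | yes i<k = ⊥-elim (<⇒≱ (embed-pres-< i<k) ιi≥k)
      ... | no  i≮k = ≮⇒≥ i≮k

      InI-sub : ∀ {X} → InI k N X → InI k ∣ L ∣ (sub X)
      InI-sub hX i j =
          (λ i<k j<k → trans (proj₁ (hX _ _) (embed-pres-< i<k) (embed-pres-< j<k)) (δ-embed i j))
        , (λ i≥k j<k → proj₁ (proj₂ (hX _ _)) (embed-pres-≥ i≥k) (embed-pres-< j<k))
        , (λ i≥k j≥k i≢j → proj₂ (proj₂ (hX _ _)) (embed-pres-≥ i≥k) (embed-pres-≥ j≥k) (i≢j ∘ embed-injective L))

      InI-ext : ∀ {Y} → InI k ∣ L ∣ Y → InI k N (ext Y)
      InI-ext {Y} hY i j with embed-or-∉ L i | embed-or-∉ L j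
      ... | inj₁ (i′ , ≡.refl) | inj₁ (j′ , ≡.refl) =
          (λ i<k j<k → trans e (trans (proj₁ (hY i′ j′) (embed-refl-< i<k) (embed-refl-< j<k)) (sym (δ-embed i′ j′))))
        , (λ i≥k j<k → trans e (proj₁ (proj₂ (hY i′ j′)) (embed-refl-≥ i≥k) (embed-refl-< j<k)))
        , (λ i≥k j≥k i≢j → trans e (proj₂ (proj₂ (hY i′ j′)) (embed-refl-≥ i≥k) (embed-refl-≥ j≥k) (i≢j ∘ ≡.cong (embed L))))
        where
        e : ext Y (embed L i′) (embed L j′) ≈ Y i′ j′
        e = sub-ext Y i′ j′
      ... | inj₂ i∉L | _ =
          (λ i<k _ → ⊥-elim (<⇒≱ i<k (∉⇒≥ i∉L))) , (λ _ _ → e) , (λ _ _ _ → e)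
        where
        e : ext Y i j ≈ 0#
        e = ext-supported Y i j (inj₁ i∉L)
      ... | inj₁ _ | inj₂ j∉L =
          (λ _ j<k → ⊥-elim (<⇒≱ j<k (∉⇒≥ j∉L))) , (λ _ _ → e) , (λ _ _ _ → e)
        where
        e : ext Y i j ≈ 0#
        e = ext-supported Y i j (inj₂ j∉L)

      CornerUnit : Mat N → Set (c ⊔ ℓ)
      CornerUnit X = InI k N X
                   × (∀ i j → lookup L j ≡ false → X i j ≈ 0#)
                   × (∀ i → toℕ i ≥ k → lookup L i ≡ true → ∃ λ y → X i i * y ≈ 1#)

      CornerUnit⇒Supported : ∀ {X} → CornerUnit X → Supported X
      CornerUnit⇒Supported {X} (hX , column-∉ , _) =
        diagonal-cases (λ i j → lookup L i ≡ false ⊎ lookup L j ≡ false → X i j ≈ 0#)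
          (λ i → [ column-∉ i i , column-∉ i i ])
          (λ {i} {j} i≢j → [ (λ i∉L → lower-row-off hX (∉⇒≥ i∉L) i≢j) , column-∉ i j ])

      CornerUnit⇒InG-sub : ∀ {X} → CornerUnit X → InG k ∣ L ∣ (sub X)
      CornerUnit⇒InG-sub (hX , _ , unit) =
        InI-sub hX , λ i i≥k → unit (embed L i) (embed-pres-≥ i≥k) (embed-∈ L i)

      InG⇒CornerUnit-ext : ∀ {Y} → InG k ∣ L ∣ Y → CornerUnit (ext Y)
      InG⇒CornerUnit-ext {Y} (hY , unit) =
        InI-ext hY , (λ i j j∉L → ext-supported Y i j (inj₂ j∉L)) , ext-unit
        where
        ext-unit : ∀ i → toℕ i ≥ k → lookup L i ≡ true → ∃ λ y → ext Y i i * y ≈ 1#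
        ext-unit i i≥k i∈L with embed-or-∉ L i
        ... | inj₂ i∉L = ⊥-elim (not-¬ i∈L i∉L)
        ... | inj₁ (i′ , ≡.refl) with unit i′ (embed-refl-≥ i≥k)
        ...   | y , Yy≈1 = y , trans (*-congʳ (sub-ext Y i′ i′)) Yy≈1

      CornerUnit-· : ∀ {X Y} → CornerUnit X → CornerUnit Y → CornerUnit (X · Y)
      CornerUnit-· {X} {Y} (hX , _ , unitX) (hY , column-∉Y , unitY) =
        InI-· hX hY , column-∉ , unit
        where
        column-∉ : ∀ i j → lookup L j ≡ false → (X · Y) i j ≈ 0#
        column-∉ i j j∉L = trans (reflexive (·-sum X Y i j))
          (sum-zero _ (λ l → trans (*-congˡ (column-∉Y l j j∉L)) (zeroʳ _)))
        unit : ∀ i → toℕ i ≥ k → lookup L i ≡ true → ∃ λ y → (X · Y) i i * y ≈ 1#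
        unit i i≥k i∈L with unitX i i≥k i∈L | unitY i i≥k i∈L
        ... | x , Xx≈1 | y , Yy≈1 = x * y , (begin
          (X · Y) i i * (x * y)    ≈⟨ *-congʳ (·-lower-row hX Y i i≥k) ⟩
          X i i * Y i i * (x * y)  ≈⟨ interchange _ _ _ _ ⟩
          X i i * x * (Y i i * y)  ≈⟨ *-cong Xx≈1 Yy≈1 ⟩
          1# * 1#                  ≈⟨ *-identityˡ 1# ⟩
          1#                       ∎)

      CornerUnit⇒InH : ∀ {X} → CornerUnit X → InH k N (𝟏 L) X
      CornerUnit⇒InH {X} cu =
        InH-of-inverse (proj₁ cu) (InI-ext Y⁻¹-InI)
          (·-via-ext X≈extY ≈ᴹ.refl ·-inverseʳ ext-δ)
          (·-via-ext ≈ᴹ.refl X≈extY ·-inverseˡ ext-δ)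
          (·-via-ext (≈ᴹ.sym ext-δ) X≈extY (·-identityˡ (sub X)) (≈ᴹ.sym X≈extY))
          (·-via-ext X≈extY (≈ᴹ.sym ext-δ) (·-identityʳ (sub X)) (≈ᴹ.sym X≈extY))
        where
        open Inverse (CornerUnit⇒InG-sub cu)
        X≈extY : X ≈ᴹ ext (sub X)
        X≈extY = ext-sub (CornerUnit⇒Supported cu)

      InH⇒CornerUnit : ∀ {X} → InH k N (𝟏 L) X → CornerUnit X
      InH⇒CornerUnit {X} (hX , (𝟏·-⊆-X· , _) , (_ , ·X-⊆-·𝟏)) = hX , column-∉ , unit
        where
        column-∉ : ∀ i j → lookup L j ≡ false → X i j ≈ 0#
        column-∉ i j j∉L with ·X-⊆-·𝟏 δ δ-InI
        ... | Z , _ , X≈Z𝟏 = begin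
          X i j               ≈⟨ ·-identityˡ X i j ⟨
          (δ · X) i j         ≈⟨ X≈Z𝟏 i j ⟩
          (Z · 𝟏 L) i j       ≈⟨ ·-single Z (𝟏 L) i j j (λ l l≢j → trans (*-congˡ (𝟏-off L l≢j)) (zeroʳ _)) ⟩
          Z i j * 𝟏 L j j     ≈⟨ *-congˡ (𝟏-∉ L j j∉L) ⟩
          Z i j * 0#          ≈⟨ zeroʳ _ ⟩
          0#                  ∎
        unit : ∀ i → toℕ i ≥ k → lookup L i ≡ true → ∃ λ y → X i i * y ≈ 1#
        unit i i≥k i∈L with 𝟏·-⊆-X· δ δ-InI
        ... | W , _ , 𝟏≈XW = W i i , (begin
          X i i * W i i       ≈⟨ ·-lower-row hX W i i≥k ⟨
          (X · W) i i         ≈⟨ 𝟏≈XW i i ⟨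
          (𝟏 L · δ) i i       ≈⟨ ·-identityʳ (𝟏 L) i i ⟩
          𝟏 L i i             ≈⟨ 𝟏-∈ L i i∈L ⟩
          1#                  ∎)

      H-class≅G : HIsoG k N ∣ L ∣ (𝟏 L)
      H-class≅G = record
        { closed = λ _ _ hX hY → CornerUnit⇒InH (CornerUnit-· (InH⇒CornerUnit hX) (InH⇒CornerUnit hY))
        ; φ      = λ (X , hX) → sub X , CornerUnit⇒InG-sub (InH⇒CornerUnit hX)
        ; φ-cong = λ _ _ X≈Y i j → X≈Y (embed L i) (embed L j)
        ; φ-inj  = λ (X , hX) (Y , hY) subX≈subY →
            ≈ᴹ.trans (ext-sub (supported hX)) (≈ᴹ.trans (ext-cong subX≈subY) (≈ᴹ.sym (ext-sub (supported hY))))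
        ; φ-surj = λ (Y , gY) → (ext Y , CornerUnit⇒InH (InG⇒CornerUnit-ext gY)) , sub-ext Y
        ; φ-hom  = λ _ Y hX _ → sub-· (supported hX) Y
        }
        where
        supported : ∀ {X} → InH k N (𝟏 L) X → Supported X
        supported = CornerUnit⇒Supported ∘ InH⇒CornerUnit

open import Data.Nat using (_+_; _>_)

theorem5p6 : ∀ {c ℓ} (K : Field c ℓ) (k m : ℕ) → 0 < k → 0 < m →
    (L : Subset (k + m)) → (∀ (i : Fin (k + m)) → toℕ i < k → i ∈ L) →
    ∣ L ∣ > k →
    Matrices.HIsoG K k (k + m) ∣ L ∣ (Matrices.𝟏 K L)
theorem5p6 K k m _ _ L upper⊆L _ =
  Bipartite.Corner.H-class≅G K k L (λ i i<k → []=⇒lookup (upper⊆L i i<k))
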